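{- For all nonnegative integers $m_1,\dots,m_\ell$ and $d$, \[C^{d}_{m_1+\dots+m_\ell}\ \ge\ \sum_{d_1+\dots+d_\ell=d}C^{d_1}_{m_1}\cdots C^{d_\ell}_{m_\ell},\] where the sum ranges over all tuples of nonnegative integers $(d_1,\dots,d_\ell)$ with sum $d$.
   Context: For $m\ge1$ and $d\ge0$, $C_m^d$ denotes the number of $d$-dimensional faces of the $(m-1)$-dimensional associahedron, i.e. the number of sets of exactly $m-1-d$ pairwise non-crossing diagonals of a convex $(m+2)$-gon (so $C_m^d=0$ for $d\ge m$, and for $0\le d\le m-1$, $C_m^d=\frac{1}{m+1}\binom{m-1}{d}\binom{2m-d}{m}$). By convention $C_0^0=1$ and $C_0^d=0$ for $d>0$. -}

module Defs where

open import Data.Nat using (ℕ; zero; suc; _+_; _*_; _∸_; _<ᵇ_)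
open import Data.Nat.DivMod using (_/_)
open import Data.Nat.Combinatorics using (_C_)
open import Data.List using (List; []; _∷_; map; upTo)
open import Data.Nat.ListAction using (sum)
open import Data.Bool using (if_then_else_)

-- Number of d-dimensional faces of the (m-1)-dimensional associahedron,
-- via the closed formula given in the context:
--   C_m^d = binom(m-1,d) * binom(2m-d,m) / (m+1)   for m ≥ 1, d ≤ m-1,
--   C_m^d = 0 for d ≥ m (m ≥ 1);  C_0^0 = 1, C_0^d = 0 for d > 0.
-- (The division is exact.)
Cf : ℕ → ℕ → ℕ
Cf zero zero = 1
Cf zero (suc d) = 0
Cf (suc k) d =
  if d <ᵇ suc k
  then ((k C d) * ((2 * suc k ∸ d) C (suc k))) / (suc (suc k))
  else 0

-- Sum over all tuples (d₁,…,d_ℓ) of nonnegative integers with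
-- d₁ + … + d_ℓ = d of  Cf m₁ d₁ * … * Cf m_ℓ d_ℓ,  where ms = [m₁,…,m_ℓ].
convSum : List ℕ → ℕ → ℕ
convSum [] zero = 1
convSum [] (suc d) = 0
convSum (m ∷ ms) d = sum (map (λ d₁ → Cf m d₁ * convSum ms (d ∸ d₁)) (upTo (suc d)))

-- Write Cf (k+1) d = ⌊(k C d) · ((2k+2 ∸ d) C (k+1)) / (k+2)⌋ and reduce to two factors,
-- Σ_{a+b=d} Cf (k+1) a · Cf (l+1) b ≤ Cf (k+l+2) d.  Multiplied by (k+2)(l+2), a term is at
-- most (k C a)(l C b) · ((2M ∸ d) C M) with M = k+l+2, because the binomials (2m ∸ a) C m are
-- super-multiplicative (each product is one Vandermonde term).  Vandermonde then sums
-- (k C a)(l C b) to (k+l) C d ≤ (k+l+1) C d, and M + 1 ≤ (k+2)(l+2) absorbs the denominators.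
module Submission where

open import Defs
open import Data.Nat using (ℕ; zero; suc; _+_; _*_; _∸_; _≤_; _<_; _<ᵇ_; z≤n; s≤s)
open import Data.Nat.ListAction using (sum)
open import Data.Nat.Properties
open import Data.Nat.DivMod using (_/_; m/n*n≤m; m*n/n≡m; /-monoˡ-≤)
open import Data.Nat.Combinatorics using (_C_; k>n⇒nCk≡0; nCk+nC[k+1]≡[n+1]C[k+1])
open import Data.List using (List; []; _∷_; map; upTo; applyUpTo)
open import Data.List.Properties using (map-applyUpTo)
open import Data.Bool using (true; false; T)
open import Relation.Nullary using (yes; no)
open import Relation.Binary.PropositionalEquality
open import Algebra.Properties.CommutativeSemigroup *-commutativeSemigroup
  using () renaming (interchange to *-interchange)
open import Algebra.Properties.CommutativeSemigroup +-commutativeSemigroup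
  using () renaming (interchange to +-interchange; x∙yz≈y∙xz to +-left-comm)

sumAntidiagonal : (ℕ → ℕ → ℕ) → ℕ → ℕ
sumAntidiagonal h zero    = h 0 0
sumAntidiagonal h (suc d) = h 0 (suc d) + sumAntidiagonal (λ a → h (suc a)) d

sumAntidiagonal-mono-≤ : ∀ {h h′ : ℕ → ℕ → ℕ} d → (∀ a b → a + b ≡ d → h a b ≤ h′ a b) →
                         sumAntidiagonal h d ≤ sumAntidiagonal h′ d
sumAntidiagonal-mono-≤ zero    h≤h′ = h≤h′ 0 0 refl
sumAntidiagonal-mono-≤ (suc d) h≤h′ = +-mono-≤ (h≤h′ 0 (suc d) refl)
  (sumAntidiagonal-mono-≤ d (λ a b a+b≡d → h≤h′ (suc a) b (cong suc a+b≡d)))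

sumAntidiagonal-cong : ∀ {h h′ : ℕ → ℕ → ℕ} d → (∀ a b → h a b ≡ h′ a b) →
                       sumAntidiagonal h d ≡ sumAntidiagonal h′ d
sumAntidiagonal-cong d h≡h′ = ≤-antisym
  (sumAntidiagonal-mono-≤ d (λ a b _ → ≤-reflexive (h≡h′ a b)))
  (sumAntidiagonal-mono-≤ d (λ a b _ → ≤-reflexive (sym (h≡h′ a b))))

sumAntidiagonal-+ : ∀ (h h′ : ℕ → ℕ → ℕ) d →
  sumAntidiagonal (λ a b → h a b + h′ a b) d ≡ sumAntidiagonal h d + sumAntidiagonal h′ d
sumAntidiagonal-+ h h′ zero    = refl
sumAntidiagonal-+ h h′ (suc d) = trans
  (cong (h 0 (suc d) + h′ 0 (suc d) +_)
    (sumAntidiagonal-+ (λ a → h (suc a)) (λ a → h′ (suc a)) d))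
  (+-interchange (h 0 (suc d)) (h′ 0 (suc d)) _ _)

sumAntidiagonal-zero : ∀ d → sumAntidiagonal (λ _ _ → 0) d ≡ 0
sumAntidiagonal-zero zero    = refl
sumAntidiagonal-zero (suc d) = sumAntidiagonal-zero d

sumAntidiagonal-*ʳ : ∀ (h : ℕ → ℕ → ℕ) c d →
                     sumAntidiagonal (λ a b → h a b * c) d ≡ sumAntidiagonal h d * c
sumAntidiagonal-*ʳ h c zero    = refl
sumAntidiagonal-*ʳ h c (suc d) = trans
  (cong (h 0 (suc d) * c +_) (sumAntidiagonal-*ʳ (λ a → h (suc a)) c d))
  (sym (*-distribʳ-+ c (h 0 (suc d)) _))

≤-sumAntidiagonal : ∀ (h : ℕ → ℕ → ℕ) {a b d} → a + b ≡ d → h a b ≤ sumAntidiagonal h d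
≤-sumAntidiagonal h {zero}  {b} {zero}  refl = ≤-refl
≤-sumAntidiagonal h {zero}  {b} {suc d} refl = m≤m+n (h 0 (suc d)) _
≤-sumAntidiagonal h {suc a} {b} {suc d} 1+a+b≡1+d =
  ≤-trans (≤-sumAntidiagonal (λ a → h (suc a)) (suc-injective 1+a+b≡1+d))
          (m≤n+m _ (h 0 (suc d)))

sum-upTo≡sumAntidiagonal : ∀ (h : ℕ → ℕ → ℕ) d →
  sum (map (λ a → h a (d ∸ a)) (upTo (suc d))) ≡ sumAntidiagonal h d
sum-upTo≡sumAntidiagonal h d =
  trans (cong sum (map-applyUpTo (λ a → a) _ (suc d))) (sum-applyUpTo h d)
  where
  sum-applyUpTo : ∀ (h : ℕ → ℕ → ℕ) d →
    sum (applyUpTo (λ a → h a (d ∸ a)) (suc d)) ≡ sumAntidiagonal h d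
  sum-applyUpTo h zero    = +-identityʳ (h 0 0)
  sum-applyUpTo h (suc d) = cong (h 0 (suc d) +_) (sum-applyUpTo (λ a → h (suc a)) d)

infixl 7 _⋆_

_⋆_ : (ℕ → ℕ) → (ℕ → ℕ) → ℕ → ℕ
(f ⋆ g) = sumAntidiagonal (λ a b → f a * g b)

convSum-∷ : ∀ m ms d → convSum (m ∷ ms) d ≡ (Cf m ⋆ convSum ms) d
convSum-∷ m ms = sum-upTo≡sumAntidiagonal (λ a b → Cf m a * convSum ms b)

⋆-monoʳ-≤ : ∀ f {g g′ : ℕ → ℕ} → (∀ b → g b ≤ g′ b) → ∀ d → (f ⋆ g) d ≤ (f ⋆ g′) d
⋆-monoʳ-≤ f g≤g′ d = sumAntidiagonal-mono-≤ d (λ a b _ → *-monoʳ-≤ (f a) (g≤g′ b))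

⋆-identityˡ : ∀ g d → (Cf 0 ⋆ g) d ≡ g d
⋆-identityˡ g zero    = +-identityʳ (g 0)
⋆-identityˡ g (suc d) = trans (cong (g (suc d) + 0 +_) (sumAntidiagonal-zero d))
                              (trans (+-identityʳ _) (+-identityʳ _))

⋆-identityʳ : ∀ f d → (f ⋆ Cf 0) d ≡ f d
⋆-identityʳ f zero    = *-identityʳ (f 0)
⋆-identityʳ f (suc d) = trans (cong (_+ ((λ a → f (suc a)) ⋆ Cf 0) d) (*-zeroʳ (f 0)))
                              (⋆-identityʳ (λ a → f (suc a)) d)

⋆-pascal : ∀ k g d → ((suc k C_) ⋆ g) (suc d) ≡ ((k C_) ⋆ g) (suc d) + ((k C_) ⋆ g) d
⋆-pascal k g d = begin
    g (suc d) + 0 + sumAntidiagonal (λ a b → (suc k C suc a) * g b) d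
  ≡⟨ cong (g (suc d) + 0 +_) (sumAntidiagonal-cong d pascal) ⟩
    g (suc d) + 0 + sumAntidiagonal (λ a b → (k C a) * g b + (k C suc a) * g b) d
  ≡⟨ cong (g (suc d) + 0 +_) (sumAntidiagonal-+ _ _ d) ⟩
    g (suc d) + 0 + (((k C_) ⋆ g) d + Σ-shifted)
  ≡⟨ +-left-comm (g (suc d) + 0) _ Σ-shifted ⟩
    ((k C_) ⋆ g) d + (g (suc d) + 0 + Σ-shifted)
  ≡⟨ +-comm (((k C_) ⋆ g) d) _ ⟩
    ((k C_) ⋆ g) (suc d) + ((k C_) ⋆ g) d
  ∎
  where
  open ≡-Reasoning
  Σ-shifted = sumAntidiagonal (λ a b → (k C suc a) * g b) d
  pascal : ∀ a b → (suc k C suc a) * g b ≡ (k C a) * g b + (k C suc a) * g b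
  pascal a b = trans (cong (_* g b) (sym (nCk+nC[k+1]≡[n+1]C[k+1] k a)))
                     (*-distribʳ-+ (g b) (k C a) (k C suc a))

vandermonde : ∀ k l d → ((k C_) ⋆ (l C_)) d ≡ (k + l) C d
vandermonde zero    l d       =
  trans (sumAntidiagonal-cong d 0C≡Cf0) (⋆-identityˡ (l C_) d)
  where
  0C≡Cf0 : ∀ a b → (0 C a) * (l C b) ≡ Cf 0 a * (l C b)
  0C≡Cf0 zero    b = refl
  0C≡Cf0 (suc a) b = refl
vandermonde (suc k) l zero    = refl
vandermonde (suc k) l (suc d) = begin
    ((suc k C_) ⋆ (l C_)) (suc d)
  ≡⟨ ⋆-pascal k (l C_) d ⟩
    ((k C_) ⋆ (l C_)) (suc d) + ((k C_) ⋆ (l C_)) d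
  ≡⟨ cong₂ _+_ (vandermonde k l (suc d)) (vandermonde k l d) ⟩
    (k + l) C suc d + (k + l) C d
  ≡⟨ +-comm ((k + l) C suc d) _ ⟩
    (k + l) C d + (k + l) C suc d
  ≡⟨ nCk+nC[k+1]≡[n+1]C[k+1] (k + l) d ⟩
    suc (k + l) C suc d
  ∎
  where open ≡-Reasoning

C-*-≤ : ∀ x y p q → (x C p) * (y C q) ≤ (x + y) C (p + q)
C-*-≤ x y p q = begin
  (x C p) * (y C q)           ≤⟨ ≤-sumAntidiagonal (λ a b → (x C a) * (y C b)) {p} {q} refl ⟩
  ((x C_) ⋆ (y C_)) (p + q)   ≡⟨ vandermonde x y (p + q) ⟩
  (x + y) C (p + q)           ∎
  where open ≤-Reasoning

nCk≤[1+n]Ck : ∀ n k → n C k ≤ suc n C k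
nCk≤[1+n]Ck n zero    = ≤-refl
nCk≤[1+n]Ck n (suc k) = ≤-trans (m≤n+m (n C suc k) (n C k))
                                (≤-reflexive (nCk+nC[k+1]≡[n+1]C[k+1] n k))

[m∸n]+[o∸p]≡[m+o]∸[n+p] : ∀ {m n o p} → n ≤ m → p ≤ o → (m ∸ n) + (o ∸ p) ≡ (m + o) ∸ (n + p)
[m∸n]+[o∸p]≡[m+o]∸[n+p] {m} {n} {o} {p} n≤m p≤o = begin
  (m ∸ n) + (o ∸ p)    ≡⟨ +-∸-assoc (m ∸ n) p≤o ⟨
  (m ∸ n) + o ∸ p      ≡⟨ cong (_∸ p) (+-∸-comm o n≤m) ⟨
  (m + o) ∸ n ∸ p      ≡⟨ ∸-+-assoc (m + o) n p ⟩
  (m + o) ∸ (n + p)    ∎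
  where open ≡-Reasoning

[2m∸a]Cm-*-≤ : ∀ m n {a b} → a ≤ 2 * m → b ≤ 2 * n →
  ((2 * m ∸ a) C m) * ((2 * n ∸ b) C n) ≤ (2 * (m + n) ∸ (a + b)) C (m + n)
[2m∸a]Cm-*-≤ m n {a} {b} a≤2m b≤2n =
  subst (λ x → ((2 * m ∸ a) C m) * ((2 * n ∸ b) C n) ≤ x C (m + n))
  (trans ([m∸n]+[o∸p]≡[m+o]∸[n+p] a≤2m b≤2n) (cong (_∸ (a + b)) (sym (*-distribˡ-+ 2 m n))))
  (C-*-≤ (2 * m ∸ a) (2 * n ∸ b) m n)

Cf-numerator : ℕ → ℕ → ℕ
Cf-numerator k d = (k C d) * ((2 * suc k ∸ d) C suc k)

-- For d > k the binomial k C d already vanishes, so the guard in Cf is redundant.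
Cf-suc : ∀ k d → Cf (suc k) d ≡ Cf-numerator k d / suc (suc k)
Cf-suc k d with d <ᵇ suc k in d<ᵇ1+k
... | true  = refl
... | false = sym (cong (λ x → x * ((2 * suc k ∸ d) C suc k) / suc (suc k)) (k>n⇒nCk≡0 k<d))
  where
  k<d : k < d
  k<d = ≮⇒≥ (λ d<1+k → subst T d<ᵇ1+k (<⇒<ᵇ d<1+k))

Cf-suc-vanish : ∀ {k d} → k < d → Cf (suc k) d ≡ 0
Cf-suc-vanish {k} {d} k<d =
  trans (Cf-suc k d) (cong (λ x → x * ((2 * suc k ∸ d) C suc k) / suc (suc k)) (k>n⇒nCk≡0 k<d))

Cf-suc-*-≤ : ∀ k d → Cf (suc k) d * suc (suc k) ≤ Cf-numerator k d
Cf-suc-*-≤ k d rewrite Cf-suc k d = m/n*n≤m (Cf-numerator k d) (suc (suc k))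

Cf-suc-*-Cf-suc-≤ : ∀ k l a b →
  Cf (suc k) a * Cf (suc l) b * (suc (suc k) * suc (suc l))
    ≤ (k C a) * (l C b) * ((2 * (suc k + suc l) ∸ (a + b)) C (suc k + suc l))
Cf-suc-*-Cf-suc-≤ k l a b with a ≤? k | b ≤? l
... | no a≰k | _      rewrite Cf-suc-vanish (≰⇒> a≰k) = z≤n
... | yes _  | no b≰l rewrite Cf-suc-vanish (≰⇒> b≰l) | *-zeroʳ (Cf (suc k) a) = z≤n
... | yes a≤k | yes b≤l = begin
    Cf (suc k) a * Cf (suc l) b * (suc (suc k) * suc (suc l))
  ≡⟨ *-interchange (Cf (suc k) a) (Cf (suc l) b) (suc (suc k)) (suc (suc l)) ⟩
    (Cf (suc k) a * suc (suc k)) * (Cf (suc l) b * suc (suc l))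
  ≤⟨ *-mono-≤ (Cf-suc-*-≤ k a) (Cf-suc-*-≤ l b) ⟩
    Cf-numerator k a * Cf-numerator l b
  ≡⟨ *-interchange (k C a) _ (l C b) _ ⟩
    (k C a) * (l C b) * (((2 * suc k ∸ a) C suc k) * ((2 * suc l ∸ b) C suc l))
  ≤⟨ *-monoʳ-≤ ((k C a) * (l C b)) ([2m∸a]Cm-*-≤ (suc k) (suc l) (≤2* a≤k) (≤2* b≤l)) ⟩
    (k C a) * (l C b) * ((2 * (suc k + suc l) ∸ (a + b)) C (suc k + suc l))
  ∎
  where
  open ≤-Reasoning
  ≤2* : ∀ {a k} → a ≤ k → a ≤ 2 * suc k
  ≤2* {k = k} a≤k = ≤-trans (m≤n⇒m≤1+n a≤k) (m≤n*m (suc k) 2)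

1+m+n≤[1+m]*[1+n] : ∀ m n → suc (m + n) ≤ suc m * suc n
1+m+n≤[1+m]*[1+n] m n = s≤s (begin
  m + n              ≡⟨ +-comm m n ⟩
  n + m              ≤⟨ +-monoʳ-≤ n (m≤m*n m (suc n)) ⟩
  n + m * suc n      ∎)
  where open ≤-Reasoning

Cf-suc-⋆-Cf-suc-≤ : ∀ k l d → (Cf (suc k) ⋆ Cf (suc l)) d ≤ Cf (suc k + suc l) d
Cf-suc-⋆-Cf-suc-≤ k l d = begin
    L                              ≡⟨ m*n/n≡m L (suc (suc K)) ⟨
    L * suc (suc K) / suc (suc K)  ≤⟨ /-monoˡ-≤ (suc (suc K)) L*[K+2]≤numerator ⟩
    Cf-numerator K d / suc (suc K) ≡⟨ Cf-suc K d ⟨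
    Cf (suc K) d                   ∎
  where
  open ≤-Reasoning
  K = k + suc l
  L = (Cf (suc k) ⋆ Cf (suc l)) d
  c = suc (suc k) * suc (suc l)
  W = (2 * suc K ∸ d) C suc K
  L*[K+2]≤numerator : L * suc (suc K) ≤ Cf-numerator K d
  L*[K+2]≤numerator = begin
      L * suc (suc K)
    ≤⟨ *-monoʳ-≤ L (1+m+n≤[1+m]*[1+n] (suc k) (suc l)) ⟩
      L * c
    ≡⟨ sumAntidiagonal-*ʳ (λ a b → Cf (suc k) a * Cf (suc l) b) c d ⟨
      sumAntidiagonal (λ a b → Cf (suc k) a * Cf (suc l) b * c) d
    ≤⟨ sumAntidiagonal-mono-≤ d (λ a b a+b≡d →
         subst (λ x → Cf (suc k) a * Cf (suc l) b * c
                        ≤ (k C a) * (l C b) * ((2 * suc K ∸ x) C suc K))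
               a+b≡d
               (Cf-suc-*-Cf-suc-≤ k l a b)) ⟩
      sumAntidiagonal (λ a b → (k C a) * (l C b) * W) d
    ≡⟨ sumAntidiagonal-*ʳ (λ a b → (k C a) * (l C b)) W d ⟩
      ((k C_) ⋆ (l C_)) d * W
    ≡⟨ cong (_* W) (vandermonde k l d) ⟩
      ((k + l) C d) * W
    ≤⟨ *-monoˡ-≤ W (subst (λ n → (k + l) C d ≤ n C d) (sym (+-suc k l))
                          (nCk≤[1+n]Ck (k + l) d)) ⟩
      Cf-numerator K d
    ∎

Cf-⋆-Cf-≤ : ∀ m n d → (Cf m ⋆ Cf n) d ≤ Cf (m + n) d
Cf-⋆-Cf-≤ zero    n       d = ≤-reflexive (⋆-identityˡ (Cf n) d)
Cf-⋆-Cf-≤ (suc k) zero    d = ≤-reflexive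
  (trans (⋆-identityʳ (Cf (suc k)) d) (cong (λ m → Cf m d) (sym (+-identityʳ (suc k)))))
Cf-⋆-Cf-≤ (suc k) (suc l) d = Cf-suc-⋆-Cf-suc-≤ k l d

lemma3p9 : (ms : List ℕ) (d : ℕ) → convSum ms d ≤ Cf (sum ms) d
lemma3p9 []       zero    = ≤-refl
lemma3p9 []       (suc d) = z≤n
lemma3p9 (m ∷ ms) d       = begin
  convSum (m ∷ ms) d        ≡⟨ convSum-∷ m ms d ⟩
  (Cf m ⋆ convSum ms) d     ≤⟨ ⋆-monoʳ-≤ (Cf m) (lemma3p9 ms) d ⟩
  (Cf m ⋆ Cf (sum ms)) d    ≤⟨ Cf-⋆-Cf-≤ m (sum ms) d ⟩
  Cf (m + sum ms) d         ∎
  where open ≤-Reasoning
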